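{- Let $k \geq 1$ and $\ell \in \mathbb{N}$ be integers. For every $k$-tree $G$ there exists a $k$-tree $\bar{G}$ such that every $\ell$-local book embedding of $\bar{G}$ contains a forest embedding of $G$.
   Context: All graphs are finite and simple. A $k$-tree is defined inductively: $K_{k+1}$ is a $k$-tree, and a graph obtained from a $k$-tree $G'$ by adding a new vertex whose neighbourhood in $G'$ is a clique of order $k$ is a $k$-tree. A linear embedding of a graph $G=(V,E)$ is a pair $(\prec,\mathcal{P})$ where $\prec$ is a total order on $V$ and $\mathcal{P}$ is a partition of $E$ into parts called pages. Two edges $uv, xy$ with $u\prec v$, $x \prec y$ cross if $u \prec x \prec v \prec y$ or $x \prec u \prec y \prec v$. A linear embedding is a book embedding if no two crossing edges lie in the same page. For a book embedding and a vertex $v$, let $\mathcal{P}_v$ be the set of pages containing at least one edge incident to $v$; the embedding is $\ell$-local if $|\mathcal{P}_v|\le \ell$ for all $v$. A linear embedding is a forest embedding if the edges of each page form a forest. A book embedding $(\prec,\mathcal{P})$ of a graph $\bar{G}=(\bar V,\bar E)$ contains a forest embedding of a graph $G$ if there is a set $X\subseteq \bar V$ with $G\cong \bar G[X]$ such that the linear embedding of $\bar G[X]$ obtained by restricting $\prec$ to $X$ and intersecting each page with $E(\bar G[X])$ (discarding empty parts) is a forest embedding. -}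

module Defs where

open import Data.Nat using (ℕ; zero; suc; _≤_; _<_)
open import Data.Fin using (Fin; zero; suc; inject₁; fromℕ; punchIn)
open import Data.Bool using (Bool; true; false)
open import Data.List using (List; length)
open import Data.List.Membership.Propositional using (_∈_)
open import Data.Product using (Σ; ∃; _×_; _,_)
open import Relation.Binary.PropositionalEquality using (_≡_; _≢_)
open import Relation.Nullary using (¬_)
open import Function.Definitions using (Injective)

record Graph (n : ℕ) : Set where
  field
    adj    : Fin n → Fin n → Bool
    sym    : ∀ u v → adj u v ≡ adj v u
    irrefl : ∀ v → adj v v ≡ false
open Graph public

Edge : ∀ {n} → Graph n → Fin n → Fin n → Set
Edge G u v = adj G u v ≡ true

-- Induced subgraph along a map f : Fin m → Fin n (injective in all uses).
induced : ∀ {m n} → Graph n → (Fin m → Fin n) → Graph m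
induced G f = record
  { adj = λ i j → adj G (f i) (f j)
  ; sym = λ i j → sym G (f i) (f j)
  ; irrefl = λ i → irrefl G (f i) }

NbhdIsKClique : ∀ {n} (k : ℕ) → Graph n → Fin n → Set
NbhdIsKClique {n} k G v =
  Σ (Fin k → Fin n) λ f →
    Injective _≡_ _≡_ f ×
    (∀ u → Edge G v u → ∃ λ i → f i ≡ u) ×
    (∀ i → Edge G v (f i)) ×
    (∀ i j → i ≢ j → Edge G (f i) (f j))

-- k-trees (inductive definition, invariant under relabelling):
-- a complete graph on k+1 vertices is a k-tree; a graph G on suc m vertices
-- with a vertex v such that G - v is a k-tree and N(v) is a k-clique is a k-tree.
data KTree (k : ℕ) : ∀ {n} → Graph n → Set where
  complete : (G : Graph (suc k)) → (∀ u v → u ≢ v → Edge G u v) → KTree k G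
  extend   : ∀ {m} (G : Graph (suc m)) (v : Fin (suc m)) →
             KTree k (induced G (punchIn v)) →
             NbhdIsKClique k G v →
             KTree k G

-- A linear embedding of a graph on Fin n: a total order on the vertices,
-- given by an injective ranking pos (u ≺ v iff pos u < pos v), and a partition
-- of the edges into pages, given by a symmetric page label on edges.
record LinearEmbedding {n : ℕ} (G : Graph n) : Set where
  field
    pos     : Fin n → ℕ
    pos-inj : Injective _≡_ _≡_ pos
    page    : Fin n → Fin n → ℕ
    page-sym : ∀ u v → page u v ≡ page v u
open LinearEmbedding public

-- Book embedding: crossing edges never share a page.
IsBookEmbedding : ∀ {n} {G : Graph n} → LinearEmbedding G → Set
IsBookEmbedding {n} {G} L =
  ∀ (u v x y : Fin n) → Edge G u v → Edge G x y →
    pos L u < pos L x → pos L x < pos L v → pos L v < pos L y →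
    page L u v ≢ page L x y

IsLocal : ∀ {n} {G : Graph n} → ℕ → LinearEmbedding G → Set
IsLocal {n} {G} ℓ L =
  ∀ (v : Fin n) → Σ (List ℕ) λ ps → length ps ≤ ℓ ×
    (∀ u → Edge G v u → page L v u ∈ ps)

HasCycle : ∀ {m} → (Fin m → Fin m → Set) → Set
HasCycle {m} R =
  Σ ℕ λ s → Σ (Fin (suc (suc (suc s))) → Fin m) λ f →
    Injective _≡_ _≡_ f ×
    (∀ (i : Fin (suc (suc s))) → R (f (inject₁ i)) (f (suc i))) ×
    R (f (fromℕ (suc (suc s)))) (f zero)

IsForest : ∀ {m} → (Fin m → Fin m → Set) → Set
IsForest R = ¬ HasCycle R

ContainsForestEmbedding : ∀ {m n} {Ḡ : Graph n} → LinearEmbedding Ḡ → Graph m → Set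
ContainsForestEmbedding {m} {n} {Ḡ} L G =
  Σ (Fin m → Fin n) λ φ →
    Injective _≡_ _≡_ φ ×
    (∀ i j → adj G i j ≡ adj Ḡ (φ i) (φ j)) ×
    (∀ (c : ℕ) → IsForest (λ i j → Edge Ḡ (φ i) (φ j) × page L (φ i) (φ j) ≡ c))

module Submission where

-- The construction is a "blow-up".  For a host graph H let H⁺ be H with
-- N = 3ℓk² + 1 new vertices attached to each k-clique of H, each new vertex
-- adjacent exactly to its clique; H⁺ is a k-tree whenever H is.
--   * Ramsey step: in an ℓ-local book embedding, among N vertices adjacent
--     to a common k-clique C, one sees C on k pairwise distinct pages;
--     otherwise the pigeonhole principle yields two of them seeing two
--     vertices of C on one page in the same relative position, and two of
--     those four edges cross.
--   * Extension step: given a forest embedding of G - v into H whose image of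
--     N(v) is exactly a k-clique C, send v to such a "rainbow" copy w of C.
--     Then w is a leaf on every page, so every page stays a forest.
-- The theorem follows by induction on the k-tree: each added vertex costs one
-- blow-up.  The base graph K_{k+1} is built the same way, one vertex at a
-- time, keeping its image inside a k-clique while it has at most k vertices.

open import Defs
open import Data.Bool using (Bool; true; false; not)
import Data.Bool.Properties as Boolₚ
open import Data.Empty using (⊥; ⊥-elim)
open import Data.Fin using (Fin; zero; suc; toℕ; fromℕ; inject₁; inject≤; punchIn; punchOut; _↑ˡ_; _↑ʳ_; combine; remQuot; splitAt)
open import Data.Fin.Properties using (_≟_; any?; all?; suc-injective; inject₁-injective; toℕ-inject₁; inject≤-injective; punchIn-injective; punchIn-punchOut; ↑ʳ-injective; ↑ˡ-injective; splitAt-↑ˡ; splitAt-↑ʳ; combine-injective; remQuot-combine; pigeonhole; injective⇒≤; ¬∀⟶∃¬)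
import Data.Fin.Properties as Finₚ
open import Data.List using (List; [_]; length; filter; allFin; cartesianProductWith)
import Data.List as List
open import Data.List.Membership.Propositional using (_∈_)
open import Data.List.Membership.Propositional.Properties using (∈-filter⁺; ∈-lookup; ∈-allFin; ∈-cartesianProductWith⁺)
import Data.List.Relation.Unary.Any as Any
open import Data.List.Relation.Unary.Any.Properties using (lookup-index)
import Data.List.Relation.Unary.All as All
open import Data.List.Relation.Unary.All.Properties using (all-filter)
open import Data.Nat using (ℕ; zero; suc; _+_; _*_; _≤_; _<_; z≤n)
import Data.Nat as ℕ
import Data.Nat.Properties as ℕₚ
open import Data.Product using (Σ; ∃; ∃₂; _×_; _,_; proj₁; proj₂)
open import Data.Sum using (_⊎_; inj₁; inj₂)
open import Data.Vec using (Vec; []; _∷_; tabulate)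
import Data.Vec as Vec
open import Data.Vec.Properties using (lookup∘tabulate)
open import Data.Vec.Functional using (insertAt; updateAt)
open import Data.Vec.Functional.Properties using (insertAt-lookup; insertAt-punchIn; updateAt-updates; updateAt-minimal)
open import Function using (_∘_; const)
open import Function.Bundles using (_⇔_; mk⇔; Equivalence)
open import Function.Definitions using (Injective)
open import Relation.Binary using (tri<; tri≈; tri>)
open import Relation.Binary.PropositionalEquality as Eq using (_≡_; _≢_; _≗_; refl; cong; cong₂; subst; subst₂; trans)
open import Relation.Nullary using (Dec; yes; no; does; contradiction)
open import Relation.Nullary.Decidable using (decidable-stable; ¬?; _×-dec_; _→-dec_)

-- G and H have the same adjacency.  Graph records also carry proofs, so this
-- (not _≡_) is the right sameness of graphs on a common vertex set.
_≐_ : ∀ {n} → Graph n → Graph n → Set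
G ≐ H = ∀ u v → adj G u v ≡ adj H u v

edge-distinct : ∀ {n} (G : Graph n) {u v} → Edge G u v → u ≢ v
edge-distinct G {u} e refl = contradiction (trans (Eq.sym e) (irrefl G u)) λ ()

edge-sym : ∀ {n} (G : Graph n) {u v} → Edge G u v → Edge G v u
edge-sym G {u} {v} e = trans (sym G v u) e

IsClique : ∀ {n} (k : ℕ) → Graph n → (Fin k → Fin n) → Set
IsClique k G c = ∀ x y → x ≢ y → Edge G (c x) (c y)

clique-injective : ∀ {n k} (G : Graph n) {c : Fin k → Fin n} → IsClique k G c → Injective _≡_ _≡_ c
clique-injective G c-clique {x} {y} cx≡cy with x ≟ y
... | yes x≡y = x≡y
... | no x≢y = contradiction cx≡cy (edge-distinct G (c-clique x y x≢y))

clique-resp : ∀ {n k} {G : Graph n} {c c' : Fin k → Fin n} → c ≗ c' → IsClique k G c → IsClique k G c'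
clique-resp {G = G} c≗c' c-clique x y x≢y = subst₂ (Edge G) (c≗c' x) (c≗c' y) (c-clique x y x≢y)

clique-image : ∀ {m n k} {G : Graph m} {H : Graph n} {f : Fin m → Fin n} →
  (∀ i j → adj G i j ≡ adj H (f i) (f j)) → ∀ {c} → IsClique k G c → IsClique k H (f ∘ c)
clique-image f-induced c-clique x y x≢y = trans (Eq.sym (f-induced _ _)) (c-clique x y x≢y)

clique-replace : ∀ {n k} {G : Graph n} {c : Fin k → Fin n} {z w} → IsClique k G c →
  (∀ x → x ≢ z → Edge G w (c x)) → IsClique k G (updateAt c z (const w))
clique-replace {G = G} {c} {z} c-clique w-joined x y x≢y with x ≟ z | y ≟ z
... | yes refl | yes refl = contradiction refl x≢y
... | yes refl | no y≢z =
  subst₂ (Edge G) (Eq.sym (updateAt-updates z c)) (Eq.sym (updateAt-minimal y z c y≢z)) (w-joined y y≢z)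
... | no x≢z | yes refl =
  subst₂ (Edge G) (Eq.sym (updateAt-minimal x z c x≢z)) (Eq.sym (updateAt-updates z c)) (edge-sym G (w-joined x x≢z))
... | no x≢z | no y≢z =
  subst₂ (Edge G) (Eq.sym (updateAt-minimal x z c x≢z)) (Eq.sym (updateAt-minimal y z c y≢z)) (c-clique x y x≢y)

Complete : ∀ {n} → Graph n → Set
Complete G = ∀ u v → u ≢ v → Edge G u v

complete-≐ : ∀ {n} {G H : Graph n} → Complete G → Complete H → G ≐ H
complete-≐ {G = G} {H} G-complete H-complete u v with u ≟ v
... | yes refl = trans (irrefl G u) (Eq.sym (irrefl H u))
... | no u≢v = trans (G-complete u v u≢v) (Eq.sym (H-complete u v u≢v))

K : (j : ℕ) → Graph j
K j = record { adj = distinct ; sym = distinct-sym ; irrefl = distinct-irrefl }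
  where
  distinct : Fin j → Fin j → Bool
  distinct u v = not (does (u ≟ v))

  distinct-sym : ∀ u v → distinct u v ≡ distinct v u
  distinct-sym u v with u ≟ v | v ≟ u
  ... | yes _ | yes _ = refl
  ... | no _ | no _ = refl
  ... | yes u≡v | no v≢u = contradiction (Eq.sym u≡v) v≢u
  ... | no u≢v | yes v≡u = contradiction (Eq.sym v≡u) u≢v

  distinct-irrefl : ∀ u → distinct u u ≡ false
  distinct-irrefl u with u ≟ u
  ... | yes _ = refl
  ... | no u≢u = contradiction refl u≢u

K-complete : ∀ {j} → Complete (K j)
K-complete u v u≢v with u ≟ v
... | yes u≡v = contradiction u≡v u≢v
... | no _ = refl

nbhd-resp : ∀ {n k} {G H : Graph n} {v} → G ≐ H → NbhdIsKClique k G v → NbhdIsKClique k H v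
nbhd-resp {v = v} G≐H (f , f-inj , covers , joined , f-clique) =
  f , f-inj , (λ u e → covers u (trans (G≐H v u) e)) , (λ x → trans (Eq.sym (G≐H v (f x))) (joined x)) ,
  (λ x y x≢y → trans (Eq.sym (G≐H (f x) (f y))) (f-clique x y x≢y))

k-tree-resp : ∀ {k n} {G H : Graph n} → G ≐ H → KTree k G → KTree k H
k-tree-resp {H = H} G≐H (complete G G-complete) =
  complete H (λ u v u≢v → trans (Eq.sym (G≐H u v)) (G-complete u v u≢v))
k-tree-resp {k} {H = H} G≐H (extend G v T nbhd) =
  extend H v (k-tree-resp {H = induced H (punchIn v)} (λ i j → G≐H (punchIn v i) (punchIn v j)) T)
    (nbhd-resp {k = k} {G = G} {H = H} {v = v} G≐H nbhd)

deleted-neighbourhood : ∀ {k m} (G : Graph (suc m)) (v : Fin (suc m)) → NbhdIsKClique k G v →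
  Σ (Fin k → Fin m) λ g → IsClique k (induced G (punchIn v)) g ×
    (∀ i → Edge G v (punchIn v i) ⇔ (∃ λ x → i ≡ g x))
deleted-neighbourhood {k} {m} G v (f , _ , covers , joined , f-clique) = g , g-clique , g-nbhd
  where
  v≢f : ∀ x → v ≢ f x
  v≢f x = edge-distinct G (joined x)

  g : Fin k → Fin m
  g x = punchOut (v≢f x)

  g-back : ∀ x → punchIn v (g x) ≡ f x
  g-back x = punchIn-punchOut (v≢f x)

  g-clique : IsClique k (induced G (punchIn v)) g
  g-clique x y x≢y = subst₂ (Edge G) (Eq.sym (g-back x)) (Eq.sym (g-back y)) (f-clique x y x≢y)

  g-nbhd : ∀ i → Edge G v (punchIn v i) ⇔ (∃ λ x → i ≡ g x)
  g-nbhd i = mk⇔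
    (λ e → let (x , fx≡) = covers _ e in
      x , punchIn-injective v _ _ (trans (Eq.sym fx≡) (Eq.sym (g-back x))))
    (λ (x , i≡gx) → subst (Edge G v) (trans (Eq.sym (g-back x)) (cong (punchIn v) (Eq.sym i≡gx))) (joined x))

data LastView {n : ℕ} : Fin (suc n) → Set where
  last   : LastView (fromℕ n)
  inject : (i : Fin n) → LastView (inject₁ i)

last-view : ∀ {n} (i : Fin (suc n)) → LastView i
last-view {zero} zero = last
last-view {suc n} zero = inject zero
last-view {suc n} (suc i) with last-view i
... | last = last
... | inject j = inject (suc j)

forest-mono : ∀ {m} {R S : Fin m → Fin m → Set} → (∀ {i j} → R i j → S i j) → IsForest S → IsForest R
forest-mono R⊆S S-forest (s , f , f-inj , step , close) = S-forest (s , f , f-inj , (λ i → R⊆S (step i)) , R⊆S close)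

cycle-neighbours : ∀ {m} {R : Fin m → Fin m → Set} s (f : Fin (suc (suc (suc s))) → Fin m) →
  Injective _≡_ _≡_ f → (∀ i → R (f (inject₁ i)) (f (suc i))) → R (f (fromℕ (suc (suc s)))) (f zero) →
  ∀ a → ∃₂ λ y₁ y₂ → y₁ ≢ y₂ × R y₁ (f a) × R (f a) y₂
cycle-neighbours s f f-inj step close zero =
  f (fromℕ (suc (suc s))) , f (suc zero) , (λ eq → contradiction (f-inj eq) λ ()) , close , step zero
cycle-neighbours s f f-inj step close (suc a) with last-view a
... | last =
  f (inject₁ (fromℕ (suc s))) , f zero , (λ eq → contradiction (f-inj eq) λ ()) , step (fromℕ (suc s)) , close
... | inject i =
  f (inject₁ (inject₁ i)) , f (suc (suc i)) , (λ eq → two-apart (f-inj eq)) , step (inject₁ i) , step (suc i)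
  where
  two-apart : inject₁ (inject₁ i) ≢ suc (suc i)
  two-apart eq = ℕₚ.<⇒≢ (ℕₚ.m<n⇒m<1+n (ℕₚ.n<1+n (toℕ i)))
    (trans (Eq.sym (trans (toℕ-inject₁ (inject₁ i)) (toℕ-inject₁ i))) (cong toℕ eq))

LeafIn : ∀ {m} → (Fin m → Fin m → Set) → Fin m → Set
LeafIn R v = ∀ {y₁ y₂} → y₁ ≢ y₂ → R y₁ v → R v y₂ → ⊥

-- Adding a leaf to a forest gives a forest: a cycle avoiding v lives in the
-- forest R - v, and a cycle through v would give v two neighbours.
forest-extend : ∀ {m} (R : Fin (suc m) → Fin (suc m) → Set) (v : Fin (suc m)) →
  IsForest (λ i j → R (punchIn v i) (punchIn v j)) → LeafIn R v → IsForest R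
forest-extend {m} R v forest leaf (s , f , f-inj , step , close) with any? (λ a → f a ≟ v)
... | yes (a , refl) =
  let (_ , _ , y₁≢y₂ , r₁ , r₂) = cycle-neighbours {R = R} s f f-inj step close a in leaf y₁≢y₂ r₁ r₂
... | no v∉f = forest (s , f' , f'-inj , (λ i → lower (step i)) , lower close)
  where
  v≢f : ∀ a → v ≢ f a
  v≢f a v≡fa = v∉f (a , Eq.sym v≡fa)

  f' : Fin (suc (suc (suc s))) → Fin m
  f' a = punchOut (v≢f a)

  f'-back : ∀ a → punchIn v (f' a) ≡ f a
  f'-back a = punchIn-punchOut (v≢f a)

  f'-inj : Injective _≡_ _≡_ f'
  f'-inj {a} {b} eq = f-inj (trans (Eq.sym (f'-back a)) (trans (cong (punchIn v) eq) (f'-back b)))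

  lower : ∀ {a b} → R (f a) (f b) → R (punchIn v (f' a)) (punchIn v (f' b))
  lower {a} {b} = subst₂ R (Eq.sym (f'-back a)) (Eq.sym (f'-back b))

OnPage : ∀ {n} {Ḡ : Graph n} → LinearEmbedding Ḡ → ℕ → Fin n → Fin n → Set
OnPage {Ḡ = Ḡ} L p a b = Edge Ḡ a b × page L a b ≡ p

on-page-sym : ∀ {n} {Ḡ : Graph n} (L : LinearEmbedding Ḡ) {p a b} → OnPage L p a b → OnPage L p b a
on-page-sym {Ḡ = Ḡ} L {a = a} {b} (e , on-p) = edge-sym Ḡ e , trans (page-sym L b a) on-p

record ForestEmbedding {m n : ℕ} {Ḡ : Graph n} (L : LinearEmbedding Ḡ) (G : Graph m) : Set where
  field
    φ : Fin m → Fin n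
    φ-injective : Injective _≡_ _≡_ φ
    φ-induced : ∀ i j → adj G i j ≡ adj Ḡ (φ i) (φ j)
    φ-forest : ∀ p → IsForest (λ i j → OnPage L p (φ i) (φ j))

contains : ∀ {m n} {Ḡ : Graph n} {L : LinearEmbedding Ḡ} {G : Graph m} →
  ForestEmbedding L G → ContainsForestEmbedding L G
contains ψ = φ , (λ {i} {j} → φ-injective {i} {j}) , φ-induced , φ-forest
  where open ForestEmbedding ψ

forest-embedding-resp : ∀ {m n} {Ḡ : Graph n} {L : LinearEmbedding Ḡ} {G G' : Graph m} →
  G ≐ G' → ForestEmbedding L G → ForestEmbedding L G'
forest-embedding-resp G≐G' ψ = record
  { φ = φ ; φ-injective = φ-injective
  ; φ-induced = λ i j → trans (Eq.sym (G≐G' i j)) (φ-induced i j) ; φ-forest = φ-forest }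
  where open ForestEmbedding ψ

module Restriction {m n : ℕ} {H : Graph n} (H' : Graph m) (f : Fin m → Fin n)
  (f-injective : Injective _≡_ _≡_ f) (f-induced : ∀ i j → adj H' i j ≡ adj H (f i) (f j)) where

  restrict : LinearEmbedding H → LinearEmbedding H'
  restrict L = record
    { pos = pos L ∘ f ; pos-inj = λ eq → f-injective (pos-inj L eq)
    ; page = λ i j → page L (f i) (f j) ; page-sym = λ i j → page-sym L (f i) (f j) }

  restrict-book : ∀ L → IsBookEmbedding L → IsBookEmbedding (restrict L)
  restrict-book L book u v x y e e' =
    book (f u) (f v) (f x) (f y) (trans (Eq.sym (f-induced u v)) e) (trans (Eq.sym (f-induced x y)) e')

  restrict-local : ∀ ℓ L → IsLocal ℓ L → IsLocal ℓ (restrict L)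
  restrict-local ℓ L local v =
    let (ps , few , covers) = local (f v) in
    ps , few , λ u e → covers (f u) (trans (Eq.sym (f-induced v u)) e)

  unrestrict : ∀ {L} {j} {G : Graph j} → ForestEmbedding (restrict L) G → ForestEmbedding L G
  unrestrict {L} ψ = record
    { φ = f ∘ φ ; φ-injective = λ eq → φ-injective (f-injective eq)
    ; φ-induced = λ i j → trans (φ-induced i j) (f-induced (φ i) (φ j))
    ; φ-forest = λ p →
        forest-mono {R = λ i j → OnPage L p (f (φ i)) (f (φ j))} {S = λ i j → OnPage (restrict L) p (φ i) (φ j)}
          (λ (e , on-p) → trans (f-induced _ _) e , on-p) (φ-forest p) }
    where open ForestEmbedding ψ

punchIn-view : ∀ {m} (v x : Fin (suc m)) → x ≡ v ⊎ ∃ λ i → x ≡ punchIn v i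
punchIn-view v x with v ≟ x
... | yes v≡x = inj₁ (Eq.sym v≡x)
... | no v≢x = inj₂ (punchOut v≢x , Eq.sym (punchIn-punchOut v≢x))

insertAt-injective : ∀ {m} {X : Set} (ψ : Fin m → X) v w → Injective _≡_ _≡_ ψ → (∀ i → w ≢ ψ i) →
  Injective _≡_ _≡_ (insertAt ψ v w)
insertAt-injective ψ v w ψ-inj fresh {x} {y} eq with punchIn-view v x | punchIn-view v y
... | inj₁ refl | inj₁ refl = refl
... | inj₁ refl | inj₂ (j , refl) =
  ⊥-elim (fresh j (trans (Eq.sym (insertAt-lookup ψ v w)) (trans eq (insertAt-punchIn ψ v w j))))
... | inj₂ (i , refl) | inj₁ refl =
  ⊥-elim (fresh i (trans (Eq.sym (insertAt-lookup ψ v w)) (trans (Eq.sym eq) (insertAt-punchIn ψ v w i))))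
... | inj₂ (i , refl) | inj₂ (j , refl) =
  cong (punchIn v) (ψ-inj (trans (Eq.sym (insertAt-punchIn ψ v w i)) (trans eq (insertAt-punchIn ψ v w j))))

-- A forest embedding ψ of G - v extends to G by sending v
-- to a fresh vertex w whose adjacency to the image matches that of v and
-- whose edges to the image lie on pairwise distinct pages: w is then a leaf
-- on every page.
extend-embedding : ∀ {m n} {Ḡ : Graph n} (L : LinearEmbedding Ḡ) (G : Graph (suc m)) (v : Fin (suc m))
  (ψ : ForestEmbedding L (induced G (punchIn v))) (w : Fin n) →
  let φ₀ = ForestEmbedding.φ ψ in
  (∀ i → w ≢ φ₀ i) →
  (∀ i → adj G v (punchIn v i) ≡ adj Ḡ w (φ₀ i)) →
  (∀ i j → i ≢ j → Edge Ḡ w (φ₀ i) → Edge Ḡ w (φ₀ j) → page L w (φ₀ i) ≢ page L w (φ₀ j)) →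
  ForestEmbedding L G
extend-embedding {m} {n} {Ḡ} L G v ψ w fresh same-adjacency rainbow = record
  { φ = φ ; φ-injective = insertAt-injective φ₀ v w φ₀-injective fresh
  ; φ-induced = φ-induced ; φ-forest = φ-forest }
  where
  open ForestEmbedding ψ
    renaming (φ to φ₀; φ-injective to φ₀-injective; φ-induced to φ₀-induced; φ-forest to φ₀-forest)

  φ : Fin (suc m) → Fin n
  φ = insertAt φ₀ v w

  φ-new : φ v ≡ w
  φ-new = insertAt-lookup φ₀ v w

  φ-old : ∀ i → φ (punchIn v i) ≡ φ₀ i
  φ-old = insertAt-punchIn φ₀ v w

  at-new : ∀ i → adj G v (punchIn v i) ≡ adj Ḡ (φ v) (φ (punchIn v i))
  at-new i = trans (same-adjacency i) (Eq.sym (cong₂ (adj Ḡ) φ-new (φ-old i)))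

  φ-induced : ∀ x y → adj G x y ≡ adj Ḡ (φ x) (φ y)
  φ-induced x y with punchIn-view v x | punchIn-view v y
  ... | inj₁ refl | inj₁ refl = trans (irrefl G v) (Eq.sym (irrefl Ḡ (φ v)))
  ... | inj₁ refl | inj₂ (j , refl) = at-new j
  ... | inj₂ (i , refl) | inj₁ refl = trans (sym G _ _) (trans (at-new i) (sym Ḡ _ _))
  ... | inj₂ (i , refl) | inj₂ (j , refl) = trans (φ₀-induced i j) (Eq.sym (cong₂ (adj Ḡ) (φ-old i) (φ-old j)))

  φ-forest : ∀ p → IsForest (λ i j → OnPage L p (φ i) (φ j))
  φ-forest p = forest-extend (λ i j → OnPage L p (φ i) (φ j)) v
    (forest-mono {S = λ i j → OnPage L p (φ₀ i) (φ₀ j)}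
      (λ {i} {j} → subst₂ (OnPage L p) (φ-old i) (φ-old j)) (φ₀-forest p))
    leaf
    where
    leaf : LeafIn (λ i j → OnPage L p (φ i) (φ j)) v
    leaf {y₁} {y₂} y₁≢y₂ r₁ r₂ with punchIn-view v y₁ | punchIn-view v y₂
    ... | inj₁ refl | _ = edge-distinct Ḡ (proj₁ r₁) refl
    ... | inj₂ _ | inj₁ refl = edge-distinct Ḡ (proj₁ r₂) refl
    ... | inj₂ (i , refl) | inj₂ (j , refl) =
      rainbow i j (y₁≢y₂ ∘ cong (punchIn v)) (proj₁ s₁) (proj₁ s₂) (trans (proj₂ s₁) (Eq.sym (proj₂ s₂)))
      where
      s₁ : OnPage L p w (φ₀ i)
      s₁ = on-page-sym L (subst₂ (OnPage L p) (φ-old i) φ-new r₁)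
      s₂ : OnPage L p w (φ₀ j)
      s₂ = subst₂ (OnPage L p) φ-new (φ-old j) r₂

RainbowStar : ∀ {n k} {H : Graph n} → LinearEmbedding H → Fin n → (Fin k → Fin n) → Set
RainbowStar L w C = ∀ x y → x ≢ y → page L w (C x) ≢ page L w (C y)

data Region (w a b : ℕ) : Fin 3 → Set where
  before  : w < a → Region w a b zero
  between : a ≤ w → w < b → Region w a b (suc zero)
  after   : b ≤ w → Region w a b (suc (suc zero))

region : ∀ w a b → Σ (Fin 3) (Region w a b)
region w a b with w ℕₚ.<? a
... | yes w<a = zero , before w<a
... | no w≮a with w ℕₚ.<? b
...   | yes w<b = suc zero , between (ℕₚ.≮⇒≥ w≮a) w<b
...   | no w≮b = suc (suc zero) , after (ℕₚ.≮⇒≥ w≮b)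

module Ramsey {n ℓ : ℕ} {H : Graph n} (L : LinearEmbedding H) (book : IsBookEmbedding L) (local : IsLocal ℓ L) where

  strict : ∀ {x y} → pos L x ≤ pos L y → x ≢ y → pos L x < pos L y
  strict x≤y x≢y = ℕₚ.≤∧≢⇒< x≤y (x≢y ∘ pos-inj L)

  same-region-cross : ∀ {a b u₁ u₂ p r} → pos L a < pos L b → pos L u₁ < pos L u₂ →
    OnPage L p u₁ a → OnPage L p u₁ b → OnPage L p u₂ a → OnPage L p u₂ b →
    Region (pos L u₁) (pos L a) (pos L b) r → Region (pos L u₂) (pos L a) (pos L b) r → ⊥
  same-region-cross {a} {b} {u₁} {u₂} a≺b u₁≺u₂ (e₁a , p₁a) (e₁b , p₁b) (e₂a , p₂a) (e₂b , p₂b)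
      (before _) (before u₂≺a) =
    book u₁ a u₂ b e₁a e₂b u₁≺u₂ u₂≺a a≺b (trans p₁a (Eq.sym p₂b))
  same-region-cross {a} {b} {u₁} {u₂} a≺b u₁≺u₂ (e₁a , p₁a) (e₁b , p₁b) (e₂a , p₂a) (e₂b , p₂b)
      (between a≤u₁ _) (between _ u₂≺b) =
    book a u₂ u₁ b (edge-sym H e₂a) e₁b (strict a≤u₁ (edge-distinct H e₁a ∘ Eq.sym)) u₁≺u₂ u₂≺b
      (trans (page-sym L a u₂) (trans p₂a (Eq.sym p₁b)))
  same-region-cross {a} {b} {u₁} {u₂} a≺b u₁≺u₂ (e₁a , p₁a) (e₁b , p₁b) (e₂a , p₂a) (e₂b , p₂b)
      (after b≤u₁) (after _) =
    book a u₁ b u₂ (edge-sym H e₁a) (edge-sym H e₂b) a≺b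
      (strict b≤u₁ (edge-distinct H e₁b ∘ Eq.sym)) u₁≺u₂
      (trans (page-sym L a u₁) (trans p₁a (Eq.sym (trans (page-sym L b u₂) p₂b))))

  two-stars-cross : ∀ {a b u₁ u₂ p r} → pos L a < pos L b → u₁ ≢ u₂ →
    OnPage L p u₁ a → OnPage L p u₁ b → OnPage L p u₂ a → OnPage L p u₂ b →
    Region (pos L u₁) (pos L a) (pos L b) r → Region (pos L u₂) (pos L a) (pos L b) r → ⊥
  two-stars-cross {u₁ = u₁} {u₂} a≺b u₁≢u₂ s₁a s₁b s₂a s₂b ρ₁ ρ₂
    with ℕₚ.<-cmp (pos L u₁) (pos L u₂)
  ... | tri< u₁≺u₂ _ _ = same-region-cross a≺b u₁≺u₂ s₁a s₁b s₂a s₂b ρ₁ ρ₂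
  ... | tri≈ _ same _ = u₁≢u₂ (pos-inj L same)
  ... | tri> _ _ u₂≺u₁ = same-region-cross a≺b u₂≺u₁ s₂a s₂b s₁a s₁b ρ₂ ρ₁

  pages : Fin n → List ℕ
  pages v = proj₁ (local v)

  page∈ : ∀ v u → Edge H v u → page L v u ∈ pages v
  page∈ v = proj₂ (proj₂ (local v))

  slot : ∀ v u → Edge H v u → Fin ℓ
  slot v u e = inject≤ (Any.index (page∈ v u e)) (proj₁ (proj₂ (local v)))

  slot-page : ∀ v {u u'} (e : Edge H v u) (e' : Edge H v u') →
    slot v u e ≡ slot v u' e' → page L v u ≡ page L v u'
  slot-page v {u} {u'} e e' same-slot =
    trans (lookup-index (page∈ v u e))
      (trans (cong (List.lookup (pages v)) (inject≤-injective _ _ _ _ same-slot))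
        (Eq.sym (lookup-index (page∈ v u' e'))))

  module _ {k : ℕ} (W : Fin (suc (k * k * ℓ * 3)) → Fin n) (W-inj : Injective _≡_ _≡_ W)
    (C : Fin k → Fin n) (C-inj : Injective _≡_ _≡_ C) (joined : ∀ t x → Edge H (W t) (C x)) where

    record Collision (t : Fin (suc (k * k * ℓ * 3))) : Set where
      constructor collision
      field
        x y : Fin k
        x≺y : pos L (C x) < pos L (C y)
        same : page L (W t) (C x) ≡ page L (W t) (C y)

    Bad : Fin (suc (k * k * ℓ * 3)) → Set
    Bad t = ∃₂ λ x y → x ≢ y × page L (W t) (C x) ≡ page L (W t) (C y)

    bad? : ∀ t → Dec (Bad t)
    bad? t = any? λ x → any? λ y → ¬? (x ≟ y) ×-dec (page L (W t) (C x) ℕ.≟ page L (W t) (C y))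

    orient : ∀ t → Bad t → Collision t
    orient t (x , y , x≢y , same) with ℕₚ.<-cmp (pos L (C x)) (pos L (C y))
    ... | tri< x≺y _ _ = collision x y x≺y same
    ... | tri≈ _ eq _ = contradiction (C-inj (pos-inj L eq)) x≢y
    ... | tri> _ _ y≺x = collision y x y≺x (Eq.sym same)

    -- A collision is summarised by (x, y, slot of the page at C x, region of
    -- W t); there are only k·k·ℓ·3 such signatures.
    code : Fin k → Fin k → Fin ℓ → Fin 3 → Fin (k * k * ℓ * 3)
    code x y s r = combine (combine (combine x y) s) r

    code-injective : ∀ x y s r x' y' s' r' → code x y s r ≡ code x' y' s' r' →
      x ≡ x' × y ≡ y' × s ≡ s' × r ≡ r'
    code-injective x y s r x' y' s' r' eq =
      let (xys≡ , r≡) = combine-injective (combine (combine x y) s) r (combine (combine x' y') s') r' eq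
          (xy≡ , s≡) = combine-injective (combine x y) s (combine x' y') s' xys≡
          (x≡ , y≡) = combine-injective x y x' y' xy≡
      in x≡ , y≡ , s≡ , r≡

    slot-of : ∀ t x → Fin ℓ
    slot-of t x = slot (C x) (W t) (edge-sym H (joined t x))

    region-of : ∀ t x y → Fin 3
    region-of t x y = proj₁ (region (pos L (W t)) (pos L (C x)) (pos L (C y)))

    signature : ∀ t → Collision t → Fin (k * k * ℓ * 3)
    signature t (collision x y _ _) = code x y (slot-of t x) (region-of t x y)

    -- Equal signatures of distinct t, t' give two stars that must cross.
    signatures-differ : ∀ {t t'} → t ≢ t' → (κ : Collision t) (κ' : Collision t') →
      signature t κ ≢ signature t' κ'
    signatures-differ {t} {t'} t≢t' (collision x y x≺y same) (collision x' y' _ same') same-signature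
      with code-injective x y (slot-of t x) (region-of t x y) x' y' (slot-of t' x') (region-of t' x' y') same-signature
    ... | refl , refl , same-slot , same-region =
      two-stars-cross {p = page L (W t) (C x)} x≺y (λ eq → t≢t' (W-inj eq))
        (joined t x , refl) (joined t y , Eq.sym same)
        (joined t' x , p₂a) (joined t' y , trans (Eq.sym same') p₂a)
        (proj₂ (region _ _ _))
        (subst (Region (pos L (W t')) (pos L (C x)) (pos L (C y))) (Eq.sym same-region) (proj₂ (region _ _ _)))
      where
      p₂a : page L (W t') (C x) ≡ page L (W t) (C x)
      p₂a = trans (page-sym L _ _)
        (trans (Eq.sym (slot-page (C x) (edge-sym H (joined t x)) (edge-sym H (joined t' x)) same-slot))
          (page-sym L _ _))

    not-all-collide : (∀ t → Collision t) → ⊥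
    not-all-collide κ with pigeonhole (ℕₚ.n<1+n _) (λ t → signature t (κ t))
    ... | i , j , i<j , same-signature = signatures-differ (Finₚ.<⇒≢ i<j) (κ i) (κ j) same-signature

    rainbow-star : ∃ λ t → RainbowStar L (W t) C
    rainbow-star with any? (λ t → ¬? (bad? t))
    ... | yes (t , good) = t , λ x y x≢y same → good (x , y , x≢y , same)
    ... | no none =
      ⊥-elim (not-all-collide λ t → orient t (decidable-stable (bad? t) (λ good → none (t , good))))

-- Attaching new vertices to cliques of G: A new vertices are put in front of
-- the vertices of G, the a-th one adjacent exactly to the clique cl a.
module Attach {n k : ℕ} (G : Graph n) where

  joins : ∀ A → (Fin k → Fin n) → Fin (A + n) → Bool
  joins A c y = does (any? λ x → y ≟ A ↑ʳ c x)

  joins-spec : ∀ A c y → joins A c y ≡ true ⇔ (∃ λ x → y ≡ A ↑ʳ c x)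
  joins-spec A c y with any? (λ x → y ≟ A ↑ʳ c x)
  ... | yes found = mk⇔ (λ _ → found) (λ _ → refl)
  ... | no none = mk⇔ (λ ()) (λ found → contradiction found none)

  attach-adj : ∀ A → (Fin A → Fin k → Fin n) → Fin (A + n) → Fin (A + n) → Bool
  attach-adj zero    cl u       v       = adj G u v
  attach-adj (suc A) cl zero    zero    = false
  attach-adj (suc A) cl zero    (suc v) = joins A (cl zero) v
  attach-adj (suc A) cl (suc u) zero    = joins A (cl zero) u
  attach-adj (suc A) cl (suc u) (suc v) = attach-adj A (cl ∘ suc) u v

  attach-sym : ∀ A cl u v → attach-adj A cl u v ≡ attach-adj A cl v u
  attach-sym zero    cl u       v       = sym G u v
  attach-sym (suc A) cl zero    zero    = refl
  attach-sym (suc A) cl zero    (suc v) = refl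
  attach-sym (suc A) cl (suc u) zero    = refl
  attach-sym (suc A) cl (suc u) (suc v) = attach-sym A (cl ∘ suc) u v

  attach-irrefl : ∀ A cl u → attach-adj A cl u u ≡ false
  attach-irrefl zero    cl u       = irrefl G u
  attach-irrefl (suc A) cl zero    = refl
  attach-irrefl (suc A) cl (suc u) = attach-irrefl A (cl ∘ suc) u

  attach : ∀ A → (Fin A → Fin k → Fin n) → Graph (A + n)
  attach A cl = record { adj = attach-adj A cl ; sym = attach-sym A cl ; irrefl = attach-irrefl A cl }

  attach-old : ∀ A cl x y → adj (attach A cl) (A ↑ʳ x) (A ↑ʳ y) ≡ adj G x y
  attach-old zero    cl x y = refl
  attach-old (suc A) cl x y = attach-old A (cl ∘ suc) x y

  attach-new : ∀ A cl (a : Fin A) y → Edge (attach A cl) (a ↑ˡ n) (A ↑ʳ y) ⇔ (∃ λ x → y ≡ cl a x)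
  attach-new (suc A) cl zero y = mk⇔
    (λ e → let (x , eq) = Equivalence.to (joins-spec A (cl zero) _) e in x , ↑ʳ-injective A _ _ eq)
    (λ (x , eq) → Equivalence.from (joins-spec A (cl zero) _) (x , cong (A ↑ʳ_) eq))
  attach-new (suc A) cl (suc a) y = attach-new A (cl ∘ suc) a y

  attach-k-tree : KTree k G → ∀ A cl → (∀ a → IsClique k G (cl a)) → KTree k (attach A cl)
  attach-k-tree T zero cl _ = k-tree-resp (λ _ _ → refl) T
  attach-k-tree T (suc A) cl cliques =
    extend (attach (suc A) cl) zero (k-tree-resp (λ _ _ → refl) (attach-k-tree T A (cl ∘ suc) (cliques ∘ suc))) nbhd
    where
    c : Fin k → Fin n
    c = cl zero

    f : Fin k → Fin (suc (A + n))
    f x = suc (A ↑ʳ c x)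

    covers : ∀ u → Edge (attach (suc A) cl) zero u → ∃ λ x → f x ≡ u
    covers zero ()
    covers (suc u) e = let (x , eq) = Equivalence.to (joins-spec A c u) e in x , cong suc (Eq.sym eq)

    nbhd : NbhdIsKClique k (attach (suc A) cl) zero
    nbhd = f , (λ eq → clique-injective G (cliques zero) (↑ʳ-injective A _ _ (suc-injective eq))) , covers ,
      (λ x → Equivalence.from (joins-spec A c _) (x , refl)) ,
      (λ x y x≢y → trans (attach-old A (cl ∘ suc) (c x) (c y)) (cliques zero x y x≢y))

vectors : ∀ n k → List (Vec (Fin n) k)
vectors n zero = [ [] ]
vectors n (suc k) = cartesianProductWith _∷_ (allFin n) (vectors n k)

vectors-complete : ∀ {n k} (xs : Vec (Fin n) k) → xs ∈ vectors n k
vectors-complete [] = Any.here refl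
vectors-complete (x ∷ xs) = ∈-cartesianProductWith⁺ _∷_ (∈-allFin x) (vectors-complete xs)

module Cliques {n : ℕ} (k : ℕ) (G : Graph n) where

  clique? : (c : Fin k → Fin n) → Dec (IsClique k G c)
  clique? c = all? λ x → all? λ y → ¬? (x ≟ y) →-dec (adj G (c x) (c y) Boolₚ.≟ true)

  all-cliques : List (Vec (Fin n) k)
  all-cliques = filter (clique? ∘ Vec.lookup) (vectors n k)

  count : ℕ
  count = length all-cliques

  clique : Fin count → Fin k → Fin n
  clique q = Vec.lookup (List.lookup all-cliques q)

  clique-valid : ∀ q → IsClique k G (clique q)
  clique-valid q = All.lookup (all-filter (clique? ∘ Vec.lookup) (vectors n k)) (∈-lookup {xs = all-cliques} q)

  clique-index : ∀ c → IsClique k G c → ∃ λ q → clique q ≗ c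
  clique-index c c-clique = Any.index listed , λ x →
    trans (cong (λ xs → Vec.lookup xs x) (Eq.sym (lookup-index listed))) (lookup∘tabulate c x)
    where
    listed : tabulate c ∈ all-cliques
    listed = ∈-filter⁺ (clique? ∘ Vec.lookup) (vectors-complete (tabulate c))
      (clique-resp {G = G} (λ x → Eq.sym (lookup∘tabulate c x)) c-clique)

module BlowUp (k ℓ : ℕ) {n : ℕ} (H : Graph n) where
  open Cliques k H
  open Attach {n} {k} H

  N : ℕ
  N = suc (k * k * ℓ * 3)

  copies : ℕ
  copies = count * N

  owner : Fin copies → Fin k → Fin n
  owner a = clique (proj₁ (remQuot N a))

  H⁺ : Graph (copies + n)
  H⁺ = attach copies owner

  blow-up-k-tree : KTree k H → KTree k H⁺
  blow-up-k-tree T = attach-k-tree T copies owner (λ a → clique-valid _)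

  lift : Fin n → Fin (copies + n)
  lift = copies ↑ʳ_

  lift-induced : ∀ x y → adj H x y ≡ adj H⁺ (lift x) (lift y)
  lift-induced x y = Eq.sym (attach-old copies owner x y)

  open Restriction {H = H⁺} H lift (↑ʳ-injective copies _ _) lift-induced public

  copy : Fin count → Fin N → Fin (copies + n)
  copy q t = combine q t ↑ˡ n

  copy-injective : ∀ q → Injective _≡_ _≡_ (copy q)
  copy-injective q {t} {t'} eq = proj₂ (combine-injective q t q t' (↑ˡ-injective n _ _ eq))

  copy-fresh : ∀ q t y → copy q t ≢ lift y
  copy-fresh q t y eq = contradiction
    (trans (Eq.sym (splitAt-↑ˡ copies (combine q t) n)) (trans (cong (splitAt copies) eq) (splitAt-↑ʳ copies n y)))
    λ ()

  copy-neighbours : ∀ q t y → Edge H⁺ (copy q t) (lift y) ⇔ (∃ λ x → y ≡ clique q x)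
  copy-neighbours q t y = subst (λ P → Edge H⁺ (copy q t) (lift y) ⇔ P)
    (cong (λ r → ∃ λ x → y ≡ clique (proj₁ r) x) (remQuot-combine q t)) (attach-new copies owner (combine q t) y)

  extend-into-blow-up : (L : LinearEmbedding H⁺) → IsBookEmbedding L → IsLocal ℓ L →
    ∀ {m} (G : Graph (suc m)) (v : Fin (suc m)) (ψ : ForestEmbedding (restrict L) (induced G (punchIn v)))
    (c : Fin k → Fin n) → IsClique k H c →
    (∀ i → Edge G v (punchIn v i) ⇔ (∃ λ x → ForestEmbedding.φ ψ i ≡ c x)) →
    Σ (Fin (copies + n)) λ w → (∀ x → Edge H⁺ w (lift (c x))) × ForestEmbedding L G
  extend-into-blow-up L book local G v ψ c c-clique nbhd =
    w , w-joined , extend-embedding L G v (unrestrict ψ) w (λ i → copy-fresh q t _) same-adjacency rainbow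
    where
    open ForestEmbedding ψ

    found : ∃ λ q → clique q ≗ c
    found = clique-index c c-clique

    q : Fin count
    q = proj₁ found

    neighbours : ∀ t y → Edge H⁺ (copy q t) (lift y) ⇔ (∃ λ x → y ≡ c x)
    neighbours t y = mk⇔
      (λ e → let (x , y≡) = Equivalence.to (copy-neighbours q t y) e in x , trans y≡ (proj₂ found x))
      (λ (x , y≡) → Equivalence.from (copy-neighbours q t y) (x , trans y≡ (Eq.sym (proj₂ found x))))

    joined : ∀ t x → Edge H⁺ (copy q t) (lift (c x))
    joined t x = Equivalence.from (neighbours t (c x)) (x , refl)

    star : ∃ λ t → RainbowStar L (copy q t) (lift ∘ c)
    star = Ramsey.rainbow-star L book local (copy q) (copy-injective q) (lift ∘ c)
      (λ eq → clique-injective H c-clique (↑ʳ-injective copies _ _ eq)) joined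

    t : Fin N
    t = proj₁ star

    w : Fin (copies + n)
    w = copy q t

    w-joined : ∀ x → Edge H⁺ w (lift (c x))
    w-joined = joined t

    same-adjacency : ∀ i → adj G v (punchIn v i) ≡ adj H⁺ w (lift (φ i))
    same-adjacency i = Boolₚ.⇔→≡ (mk⇔
      (λ e → let (x , φi≡cx) = Equivalence.to (nbhd i) e in
        subst (λ y → Edge H⁺ w (lift y)) (Eq.sym φi≡cx) (w-joined x))
      (λ e → Equivalence.from (nbhd i) (Equivalence.to (neighbours t (φ i)) e)))

    rainbow : ∀ i j → i ≢ j → Edge H⁺ w (lift (φ i)) → Edge H⁺ w (lift (φ j)) →
      page L w (lift (φ i)) ≢ page L w (lift (φ j))
    rainbow i j i≢j eᵢ eⱼ same-page =
      proj₂ star x y x≢y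
        (trans (cong (page L w ∘ lift) (Eq.sym φi≡cx)) (trans same-page (cong (page L w ∘ lift) φj≡cy)))
      where
      seen-i : ∃ λ x → φ i ≡ c x
      seen-i = Equivalence.to (neighbours t (φ i)) eᵢ

      seen-j : ∃ λ y → φ j ≡ c y
      seen-j = Equivalence.to (neighbours t (φ j)) eⱼ

      x y : Fin k
      x = proj₁ seen-i
      y = proj₁ seen-j

      φi≡cx : φ i ≡ c x
      φi≡cx = proj₂ seen-i

      φj≡cy : φ j ≡ c y
      φj≡cy = proj₂ seen-j

      x≢y : x ≢ y
      x≢y x≡y = i≢j (φ-injective (trans φi≡cx (trans (cong c x≡y) (Eq.sym φj≡cy))))

Universal : (k ℓ : ℕ) → ∀ {m} → Graph m → Set
Universal k ℓ G = Σ ℕ λ n → Σ (Graph n) λ Ḡ → KTree k Ḡ ×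
  ((L : LinearEmbedding Ḡ) → IsBookEmbedding L → IsLocal ℓ L → ForestEmbedding L G)

InsideClique : ∀ {m n} (k : ℕ) (Ḡ : Graph n) → (Fin m → Fin n) → Set
InsideClique {n = n} k Ḡ f = Σ (Fin k → Fin n) λ c → IsClique k Ḡ c × (∀ i → ∃ λ x → f i ≡ c x)

UniversalClique : (k ℓ j : ℕ) → Set
UniversalClique k ℓ j = Σ ℕ λ n → Σ (Graph n) λ Ḡ → KTree k Ḡ ×
  ((L : LinearEmbedding Ḡ) → IsBookEmbedding L → IsLocal ℓ L →
    Σ (ForestEmbedding L (K j)) λ ψ → j ≤ k → InsideClique k Ḡ (ForestEmbedding.φ ψ))

unhit : ∀ {j k} → j < k → (σ : Fin j → Fin k) → ∃ λ z → ∀ i → σ i ≢ z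
unhit {j} j<k σ with any? (λ z → all? λ i → ¬? (σ i ≟ z))
... | yes missed = missed
... | no none = contradiction (injective⇒≤ τ-injective) (ℕₚ.<⇒≱ j<k)
  where
  hit : ∀ z → ∃ λ i → σ i ≡ z
  hit z = let (i , ¬¬hit) = ¬∀⟶∃¬ j (λ i → σ i ≢ z) (λ i → ¬? (σ i ≟ z)) (λ all → none (z , all)) in
    i , decidable-stable (σ i ≟ z) ¬¬hit

  τ-injective : Injective _≡_ _≡_ (proj₁ ∘ hit)
  τ-injective {z} {z'} eq = trans (Eq.sym (proj₂ (hit z))) (trans (cong σ eq) (proj₂ (hit z')))

module CliqueHosts (k ℓ : ℕ) where

  start : UniversalClique k ℓ 0
  start = suc k , K (suc k) , complete (K (suc k)) K-complete , λ L _ _ → empty L ,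
    λ _ → inject₁ , (λ x y x≢y → K-complete _ _ (x≢y ∘ inject₁-injective)) , λ ()
    where
    no-vertex : Fin 0 → ⊥
    no-vertex ()

    empty : ∀ L → ForestEmbedding L (K 0)
    empty L = record
      { φ = λ () ; φ-injective = λ {i} _ → ⊥-elim (no-vertex i) ; φ-induced = λ ()
      ; φ-forest = λ _ (_ , f , _) → no-vertex (f zero) }

  -- One more vertex: the new vertex of K (suc j) goes to a copy w attached
  -- to the k-clique containing the image of K j; if suc j ≤ k, w replaces
  -- a vertex of that clique not used by K j.
  grow : ∀ {j} → j ≤ k → UniversalClique k ℓ j → UniversalClique k ℓ (suc j)
  grow {j} j≤k (n , Ḡ , T , embed) = copies + n , H⁺ , blow-up-k-tree T , embed⁺
    where
    open BlowUp k ℓ Ḡ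

    K-minus-zero : K j ≐ induced (K (suc j)) (punchIn zero)
    K-minus-zero = complete-≐ {G = K j} {H = induced (K (suc j)) (punchIn zero)} K-complete
      (λ u v u≢v → K-complete (suc u) (suc v) (u≢v ∘ suc-injective))

    embed⁺ : (L : LinearEmbedding H⁺) → IsBookEmbedding L → IsLocal ℓ L →
      Σ (ForestEmbedding L (K (suc j))) λ ψ → suc j ≤ k → InsideClique k H⁺ (ForestEmbedding.φ ψ)
    embed⁺ L book local = let (ψ , inside) = embed (restrict L) (restrict-book L book) (restrict-local ℓ L local) in
      grow-inside ψ (inside j≤k)
      where
      grow-inside : (ψ : ForestEmbedding (restrict L) (K j)) → InsideClique k Ḡ (ForestEmbedding.φ ψ) →
        Σ (ForestEmbedding L (K (suc j))) λ ψ⁺ → suc j ≤ k → InsideClique k H⁺ (ForestEmbedding.φ ψ⁺)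
      grow-inside ψ (c , c-clique , covered) = ψ⁺ , inside⁺
        where
        extension : Σ (Fin (copies + n)) λ w → (∀ x → Edge H⁺ w (lift (c x))) × ForestEmbedding L (K (suc j))
        extension = extend-into-blow-up L book local (K (suc j)) zero (forest-embedding-resp K-minus-zero ψ) c c-clique
          (λ i → mk⇔ (λ _ → covered i) (λ _ → K-complete zero (suc i) λ ()))

        w : Fin (copies + n)
        w = proj₁ extension

        ψ⁺ : ForestEmbedding L (K (suc j))
        ψ⁺ = proj₂ (proj₂ extension)

        σ : Fin j → Fin k
        σ i = proj₁ (covered i)

        inside⁺ : suc j ≤ k → InsideClique k H⁺ (ForestEmbedding.φ ψ⁺)
        inside⁺ j<k = updateAt (lift ∘ c) z (const w) ,
          clique-replace {G = H⁺} {z = z} (clique-image {G = Ḡ} {H = H⁺} {f = lift} lift-induced c-clique)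
            (λ x _ → proj₁ (proj₂ extension) x) ,
          covers
          where
          z : Fin k
          z = proj₁ (unhit j<k σ)

          covers : ∀ i → ∃ λ x → ForestEmbedding.φ ψ⁺ i ≡ updateAt (lift ∘ c) z (const w) x
          covers zero = z , Eq.sym (updateAt-updates z (lift ∘ c))
          covers (suc i) = σ i , trans (cong lift (proj₂ (covered i)))
            (Eq.sym (updateAt-minimal (σ i) z (lift ∘ c) (proj₂ (unhit j<k σ) i)))

  clique-hosts : ∀ j → j ≤ k → UniversalClique k ℓ (suc j)
  clique-hosts zero _ = grow z≤n start
  clique-hosts (suc j) j<k = grow j<k (clique-hosts j (ℕₚ.<⇒≤ j<k))

complete-universal : ∀ {k ℓ} (G : Graph (suc k)) → Complete G → Universal k ℓ G
complete-universal {k} {ℓ} G G-complete with CliqueHosts.clique-hosts k ℓ k ℕₚ.≤-refl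
... | n , Ḡ , T , embed =
  n , Ḡ , T , λ L book local →
    forest-embedding-resp (complete-≐ {G = K (suc k)} {H = G} K-complete G-complete) (proj₁ (embed L book local))

extend-universal : ∀ {k ℓ m} (G : Graph (suc m)) (v : Fin (suc m)) → NbhdIsKClique k G v →
  Universal k ℓ (induced G (punchIn v)) → Universal k ℓ G
extend-universal {k} {ℓ} G v nbhd (n , Ḡ , T , embed) with deleted-neighbourhood G v nbhd
... | g , g-clique , g-nbhd = copies + n , H⁺ , blow-up-k-tree T , embed⁺
  where
  open BlowUp k ℓ Ḡ

  embed⁺ : (L : LinearEmbedding H⁺) → IsBookEmbedding L → IsLocal ℓ L → ForestEmbedding L G
  embed⁺ L book local =
    proj₂ (proj₂ (extend-into-blow-up L book local G v ψ (φ ∘ g)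
      (clique-image {G = induced G (punchIn v)} {H = Ḡ} {f = φ} φ-induced g-clique) nbhd'))
    where
    ψ : ForestEmbedding (restrict L) (induced G (punchIn v))
    ψ = embed (restrict L) (restrict-book L book) (restrict-local ℓ L local)
    open ForestEmbedding ψ

    -- ψ is injective, so the neighbours of v are the i with φ i in φ ∘ g.
    nbhd' : ∀ i → Edge G v (punchIn v i) ⇔ (∃ λ x → φ i ≡ φ (g x))
    nbhd' i = mk⇔
      (λ e → let (x , i≡gx) = Equivalence.to (g-nbhd i) e in x , cong φ i≡gx)
      (λ (x , φi≡) → Equivalence.from (g-nbhd i) (x , φ-injective φi≡))

universal : ∀ {k ℓ m} {G : Graph m} → KTree k G → Universal k ℓ G
universal (complete G G-complete) = complete-universal G G-complete
universal (extend G v T nbhd) = extend-universal G v nbhd (universal T)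

-- The theorem.
lemma2 : (k ℓ : ℕ) → 1 ≤ k → ∀ {m} (G : Graph m) → KTree k G →
    Σ ℕ λ n → Σ (Graph n) λ Ḡ → KTree k Ḡ ×
    ((L : LinearEmbedding Ḡ) → IsBookEmbedding L → IsLocal ℓ L →
    ContainsForestEmbedding L G)
lemma2 k ℓ _ G T with universal {ℓ = ℓ} T
... | n , Ḡ , T̄ , embed = n , Ḡ , T̄ , λ L book local → contains (embed L book local)
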